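{- For every hypersequent $G$: if $G$ is derivable in the hypersequent calculus $\mathbf{HMR}$, then $[\![G]\!]\geq 0$ is derivable in equational logic from the axioms of modal Riesz spaces, i.e. $[\![G]\!]\geq0$ holds in every modal Riesz space under every assignment of the variables.
   Context: Modal Riesz spaces: a modal Riesz space is a Riesz space (vector lattice) $V$ with a distinguished element $1$ and a map $\Diamond:V\to V$ satisfying $0\leq 1$, $\Diamond(r_1a+r_2b)=r_1\Diamond a+r_2\Diamond b$, $\Diamond(0\sqcup a)\geq 0$ and $\Diamond(1)\leq 1$. Terms. Fix a countable set of variables $x,y,\dots$. Terms (in negation normal form) are generated by $A ::= x \mid \overline{x} \mid 0 \mid 1 \mid \overline{1} \mid A+A \mid rA \mid A\sqcup A \mid A\sqcap A \mid \Diamond A$ with $r\in\mathbb{R}_{>0}$; they are interpreted in modal Riesz spaces reading $\overline{x}$ as $-x$ and $\overline{1}$ as $-1$. Negation: $\overline{x}$ for $x$, $\overline{\overline{x}}=x$, $\overline{0}=0$, $\overline 1$ for $1$, $\overline{\overline{1}}=1$, $\overline{A+B}=\overline A+\overline B$, $\overline{rA}=r\overline A$, $\overline{A\sqcup B}=\overline A\sqcap\overline B$, $\overline{A\sqcap B}=\overline A\sqcup\overline B$, $\overline{\Diamond A}=\Diamond\overline A$. A weighted term is $r.A$ ($r>0$); a sequent $\vdash\Gamma$ has $\Gamma$ a finite (possibly empty) multiset of weighted terms; a hypersequent is a nonempty finite multiset of sequents $\vdash\Gamma_1\mid\cdots\mid\vdash\Gamma_n$; $G\mid\vdash\Gamma$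 adds a sequent. For a finite (possibly empty) sequence $\vec r=(r_1,\dots,r_n)$ of positive reals, $\vec r.A$ is the multiset $r_1.A,\dots,r_n.A$, $\sum\vec r=r_1+\dots+r_n$, $s\vec r=(sr_1,\dots,sr_n)$; $s.\Gamma$ multiplies all weights by $s>0$; if $\Gamma=r_1.A_1,\dots,r_n.A_n$ then $\Diamond\Gamma=r_1.\Diamond A_1,\dots,r_n.\Diamond A_n$. Interpretation: $[\![r.A]\!]=rA$, a sequent is the sum of its weighted terms (empty sum $0$), a hypersequent is the join of its sequents. The calculus $\mathbf{HMR}$ has the rules: INIT: $\vdash$ with no premises. W: from $G$ infer $G\mid\vdash\Gamma$. C: from $G\mid\vdash\Gamma\mid\vdash\Gamma$ infer $G\mid\vdash\Gamma$. S: from $G\mid\vdash\Gamma_1,\Gamma_2$ infer $G\mid\vdash\Gamma_1\mid\vdash\Gamma_2$. M: from $G\mid\vdash\Gamma_1$ and $G\mid\vdash\Gamma_2$ infer $G\mid\vdash\Gamma_1,\Gamma_2$. T: for $r>0$, from $G\mid\vdash r.\Gamma$ infer $G\mid\vdash\Gamma$. ID: if $\sum\vec r=\sum\vec s$, from $G\mid\vdash\Gamma$ infer $G\mid\vdash\Gamma,\vec r.x,\vec s.\overline{x}$ ($x$ a variable). 0: from $G\mid\vdash\Gamma$ infer $G\mid\vdash\Gamma,\vec r.0$. $+$: from $G\mid\vdash\Gamma,\vec r.A,\vec r.B$ infer $G\mid\vdash\Gamma,\vec r.(A+B)$. $\times$: from $G\mid\vdash\Gamma,(s\vec r).A$ infer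 $G\mid\vdash\Gamma,\vec r.(sA)$. $\sqcup$: from $G\mid\vdash\Gamma,\vec r.A\mid\vdash\Gamma,\vec r.B$ infer $G\mid\vdash\Gamma,\vec r.(A\sqcup B)$. $\sqcap$: from $G\mid\vdash\Gamma,\vec r.A$ and $G\mid\vdash\Gamma,\vec r.B$ infer $G\mid\vdash\Gamma,\vec r.(A\sqcap B)$. CAN: if $\sum\vec r=\sum\vec s$, from $G\mid\vdash\Gamma,\vec s.A,\vec r.\overline A$ infer $G\mid\vdash\Gamma$. 1: if $\sum\vec r\geq\sum\vec s$, from $G\mid\vdash\Gamma$ infer $G\mid\vdash\Gamma,\vec r.1,\vec s.\overline{1}$. $\Diamond$: if $\sum\vec r\geq\sum\vec s$, from the single-sequent hypersequent $\vdash\Gamma,\vec r.1,\vec s.\overline 1$ infer the single-sequent hypersequent $\vdash\Diamond\Gamma,\vec r.1,\vec s.\overline 1$. A derivation is a finite tree of rule instances whose leaves are INIT. -}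

module Defs where

open import Level using (0ℓ)
open import Data.Nat public using (ℕ)
open import Data.Product using (Σ; ∃; _×_; _,_; proj₁)
open import Data.Sum using (_⊎_)
open import Data.List using (List; []; _∷_; _++_; map; foldr)
open import Data.List.NonEmpty as L⁺ using (List⁺; _∷_; toList; foldr₁) renaming (_∷ʳ_ to _∷ʳ⁺_)
open import Data.List.Relation.Binary.Pointwise using (Pointwise)
open import Data.List.Relation.Binary.Permutation.Propositional using (_↭_)
open import Relation.Binary.PropositionalEquality using (_≡_; _≢_)

-- The real numbers, axiomatised as a Dedekind-complete ordered field
-- (these axioms characterise ℝ up to isomorphism).  Equality is _≡_.

record RealField : Set₁ where
  infixl 6 _+_
  infixl 7 _*_
  infix  4 _≤_
  field
    R     : Set
    0r 1r : R
    _+_ _*_ : R → R → R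
    -_    : R → R
    inv   : (x : R) → x ≢ 0r → R
    +-assoc   : ∀ x y z → (x + y) + z ≡ x + (y + z)
    +-comm    : ∀ x y → x + y ≡ y + x
    +-identityˡ : ∀ x → 0r + x ≡ x
    +-inverseˡ  : ∀ x → (- x) + x ≡ 0r
    *-assoc   : ∀ x y z → (x * y) * z ≡ x * (y * z)
    *-comm    : ∀ x y → x * y ≡ y * x
    *-identityˡ : ∀ x → 1r * x ≡ x
    *-inverseˡ  : ∀ x (p : x ≢ 0r) → inv x p * x ≡ 1r
    distribˡ  : ∀ x y z → x * (y + z) ≡ (x * y) + (x * z)
    0≢1       : 0r ≢ 1r
    _≤_       : R → R → Set
    ≤-refl    : ∀ x → x ≤ x
    ≤-trans   : ∀ {x y z} → x ≤ y → y ≤ z → x ≤ z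
    ≤-antisym : ∀ {x y} → x ≤ y → y ≤ x → x ≡ y
    ≤-total   : ∀ x y → (x ≤ y) ⊎ (y ≤ x)
    +-mono-≤  : ∀ {x y} z → x ≤ y → x + z ≤ y + z
    *-nonneg  : ∀ {x y} → 0r ≤ x → 0r ≤ y → 0r ≤ x * y
    complete  : (P : R → Set) → (∃ λ x → P x) → (∃ λ b → ∀ x → P x → x ≤ b) →
                ∃ λ s → (∀ x → P x → x ≤ s) × (∀ b → (∀ x → P x → x ≤ b) → s ≤ b)

  _<_ : R → R → Set
  x < y = (x ≤ y) × (x ≢ y)

  R>0 : Set
  R>0 = Σ R (λ r → 0r < r)

  val : R>0 → R
  val = proj₁

record ModalRiesz (F : RealField) : Set₁ where
  open RealField F using (R; 0r; 1r; _≤_) renaming (_+_ to _+ᵣ_; _*_ to _*ᵣ_)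
  infixl 6 _+_
  infixr 7 _·_
  infix  4 _⊑_
  field
    V     : Set
    𝟘 𝟙   : V
    _+_   : V → V → V
    -_    : V → V
    _·_   : R → V → V
    _⊔_ _⊓_ : V → V → V
    _⊑_   : V → V → Set
    ◇     : V → V
    +-assoc   : ∀ a b c → (a + b) + c ≡ a + (b + c)
    +-comm    : ∀ a b → a + b ≡ b + a
    +-identityˡ : ∀ a → 𝟘 + a ≡ a
    +-inverseˡ  : ∀ a → (- a) + a ≡ 𝟘
    ·-distrib-+ᵥ : ∀ r a b → r · (a + b) ≡ (r · a) + (r · b)
    ·-distrib-+ᵣ : ∀ r s a → (r +ᵣ s) · a ≡ (r · a) + (s · a)
    ·-assoc   : ∀ r s a → r · (s · a) ≡ (r *ᵣ s) · a
    ·-identity : ∀ a → 1r · a ≡ a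
    ⊑-refl    : ∀ a → a ⊑ a
    ⊑-trans   : ∀ {a b c} → a ⊑ b → b ⊑ c → a ⊑ c
    ⊑-antisym : ∀ {a b} → a ⊑ b → b ⊑ a → a ≡ b
    +-mono    : ∀ {a b} c → a ⊑ b → a + c ⊑ b + c
    ·-mono    : ∀ {a b} r → 0r ≤ r → a ⊑ b → r · a ⊑ r · b
    ⊔-upperˡ  : ∀ a b → a ⊑ a ⊔ b
    ⊔-upperʳ  : ∀ a b → b ⊑ a ⊔ b
    ⊔-least   : ∀ {a b c} → a ⊑ c → b ⊑ c → a ⊔ b ⊑ c
    ⊓-lowerˡ  : ∀ a b → a ⊓ b ⊑ a
    ⊓-lowerʳ  : ∀ a b → a ⊓ b ⊑ b
    ⊓-greatest : ∀ {a b c} → c ⊑ a → c ⊑ b → c ⊑ a ⊓ b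
    𝟘⊑𝟙       : 𝟘 ⊑ 𝟙
    ◇-linear  : ∀ r₁ r₂ a b → ◇ ((r₁ · a) + (r₂ · b)) ≡ (r₁ · ◇ a) + (r₂ · ◇ b)
    ◇-pos     : ∀ a → 𝟘 ⊑ ◇ (𝟘 ⊔ a)
    ◇-𝟙       : ◇ 𝟙 ⊑ 𝟙

module HMR (F : RealField) where
  open RealField F using (R; R>0; val; 0r; _≤_) renaming (_+_ to _+ᵣ_; _*_ to _*ᵣ_)

  infixl 6 _⊕_
  infixr 7 _⊗_

  -- terms in negation normal form; variables are natural numbers
  data Term : Set where
    var   : ℕ → Term
    covar : ℕ → Term
    zero  : Term
    one   : Term
    coone : Term
    _⊕_   : Term → Term → Term
    _⊗_   : R>0 → Term → Term
    _⊔ₜ_  : Term → Term → Term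
    _⊓ₜ_  : Term → Term → Term
    ◇ₜ    : Term → Term

  neg : Term → Term
  neg (var x) = covar x
  neg (covar x) = var x
  neg zero = zero
  neg one = coone
  neg coone = one
  neg (A ⊕ B) = neg A ⊕ neg B
  neg (r ⊗ A) = r ⊗ neg A
  neg (A ⊔ₜ B) = neg A ⊓ₜ neg B
  neg (A ⊓ₜ B) = neg A ⊔ₜ neg B
  neg (◇ₜ A) = ◇ₜ (neg A)

  -- weighted terms r.A, sequents (multisets as lists, up to _↭_),
  -- hypersequents (nonempty multisets of sequents)
  WTerm : Set
  WTerm = R>0 × Term

  Seq : Set
  Seq = List WTerm

  Hyp : Set
  Hyp = List⁺ Seq

  -- G | ⊢ Γ, where the context G may be empty
  infixl 4 _∣_
  _∣_ : List Seq → Seq → Hyp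
  G ∣ Γ = G ∷ʳ⁺ Γ

  _∙_ : List R>0 → Term → Seq
  rs ∙ A = map (λ r → r , A) rs

  Σ⃗ : List R>0 → R
  Σ⃗ = foldr (λ r acc → val r +ᵣ acc) 0r

  ◇Seq : Seq → Seq
  ◇Seq = map (λ { (r , A) → r , ◇ₜ A })

  Scaled : R>0 → Seq → Seq → Set
  Scaled s = Pointwise (λ { (t , A) (u , B) → (val t ≡ val s *ᵣ val u) × (A ≡ B) })

  ScaledW : R>0 → List R>0 → List R>0 → Set
  ScaledW s = Pointwise (λ t r → val t ≡ val s *ᵣ val r)

  -- equality of hypersequents as multisets of multisets
  _≈H_ : Hyp → Hyp → Set
  G ≈H G' = ∃ λ H → Pointwise _↭_ (toList G) H × (H ↭ toList G')

  data Der : Hyp → Set where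
    INIT : Der ([] ∣ [])
    EXCH : ∀ {G G'} → G ≈H G' → Der G → Der G'
    W    : ∀ {G Γ} → Der G → Der (toList G ∣ Γ)
    C    : ∀ {G Γ} → Der (toList (G ∣ Γ) ∣ Γ) → Der (G ∣ Γ)
    S    : ∀ {G Γ₁ Γ₂} → Der (G ∣ Γ₁ ++ Γ₂) → Der (toList (G ∣ Γ₁) ∣ Γ₂)
    M    : ∀ {G Γ₁ Γ₂} → Der (G ∣ Γ₁) → Der (G ∣ Γ₂) → Der (G ∣ Γ₁ ++ Γ₂)
    T    : ∀ {G Γ Δ} (r : R>0) → Scaled r Δ Γ → Der (G ∣ Δ) → Der (G ∣ Γ)
    ID   : ∀ {G Γ} rs ss x → Σ⃗ rs ≡ Σ⃗ ss →
           Der (G ∣ Γ) → Der (G ∣ Γ ++ rs ∙ var x ++ ss ∙ covar x)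
    ZERO : ∀ {G Γ} rs → Der (G ∣ Γ) → Der (G ∣ Γ ++ rs ∙ zero)
    PLUS : ∀ {G Γ} rs A B → Der (G ∣ Γ ++ rs ∙ A ++ rs ∙ B) → Der (G ∣ Γ ++ rs ∙ (A ⊕ B))
    TIMES : ∀ {G Γ} rs ts (s : R>0) A → ScaledW s ts rs →
           Der (G ∣ Γ ++ ts ∙ A) → Der (G ∣ Γ ++ rs ∙ (s ⊗ A))
    JOIN : ∀ {G Γ} rs A B → Der (toList (G ∣ Γ ++ rs ∙ A) ∣ Γ ++ rs ∙ B) →
           Der (G ∣ Γ ++ rs ∙ (A ⊔ₜ B))
    MEET : ∀ {G Γ} rs A B → Der (G ∣ Γ ++ rs ∙ A) → Der (G ∣ Γ ++ rs ∙ B) →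
           Der (G ∣ Γ ++ rs ∙ (A ⊓ₜ B))
    CAN  : ∀ {G Γ} rs ss A → Σ⃗ rs ≡ Σ⃗ ss →
           Der (G ∣ Γ ++ ss ∙ A ++ rs ∙ neg A) → Der (G ∣ Γ)
    ONE  : ∀ {G Γ} rs ss → Σ⃗ ss ≤ Σ⃗ rs →
           Der (G ∣ Γ) → Der (G ∣ Γ ++ rs ∙ one ++ ss ∙ coone)
    DIA  : ∀ {Γ} rs ss → Σ⃗ ss ≤ Σ⃗ rs →
           Der ([] ∣ Γ ++ rs ∙ one ++ ss ∙ coone) →
           Der ([] ∣ ◇Seq Γ ++ rs ∙ one ++ ss ∙ coone)

  module Sem (M : ModalRiesz F) (σ : ℕ → ModalRiesz.V M) where
    open ModalRiesz M

    ⟦_⟧ : Term → V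
    ⟦ var x ⟧ = σ x
    ⟦ covar x ⟧ = - σ x
    ⟦ zero ⟧ = 𝟘
    ⟦ one ⟧ = 𝟙
    ⟦ coone ⟧ = - 𝟙
    ⟦ A ⊕ B ⟧ = ⟦ A ⟧ + ⟦ B ⟧
    ⟦ r ⊗ A ⟧ = val r · ⟦ A ⟧
    ⟦ A ⊔ₜ B ⟧ = ⟦ A ⟧ ⊔ ⟦ B ⟧
    ⟦ A ⊓ₜ B ⟧ = ⟦ A ⟧ ⊓ ⟦ B ⟧
    ⟦ ◇ₜ A ⟧ = ◇ ⟦ A ⟧

    ⟦_⟧ˢ : Seq → V
    ⟦ Γ ⟧ˢ = foldr (λ { (r , A) acc → (val r · ⟦ A ⟧) + acc }) 𝟘 Γ

    ⟦_⟧ʰ : Hyp → V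
    ⟦ G ⟧ʰ = foldr₁ _⊔_ (L⁺.map ⟦_⟧ˢ G)

-- A hypersequent denotes the join of its sequents u₁ … uₙ,
-- and 𝟘 ⊑ u₁ ⊔ … ⊔ uₙ iff the negative parts uᵢ ⁻ = 𝟘 ⊔ (- uᵢ) have meet 𝟘; this is the invariant.
-- The logical rules only increase the active sequent or rewrite it by an identity of modal Riesz
-- spaces. M and ⊓ use the Riesz decomposition x ⊓ (y + z) ⊑ x ⊓ y + x ⊓ z (for x, y, z ⊒ 𝟘) with
-- (a + b) ⁻ ⊑ a ⁻ + b ⁻ and (a ⊓ b) ⁻ ⊑ a ⁻ + b ⁻; S uses a ⁻ ⊓ b ⁻ ⊑ (a + b) ⁻; T rescales the
-- common lower bound; and the modal rule uses positivity of ◇ and ◇ 𝟙 ⊑ 𝟙.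

module Submission where

open import Level using (0ℓ)
open import Defs
open import Algebra.Bundles using (AbelianGroup; Ring)
open import Algebra.Structures using (IsAbelianGroup)
open import Algebra.Consequences.Propositional using (comm∧idˡ⇒id; comm∧invˡ⇒inv; comm∧distrˡ⇒distrʳ)
import Algebra.Properties.AbelianGroup as AbelianGroupProperties
import Algebra.Properties.CommutativeSemigroup as CommutativeSemigroupProperties
import Algebra.Properties.Ring as RingProperties
open import Data.Product using (_,_; proj₁; proj₂)
open import Data.Sum using (inj₁; inj₂)
open import Data.List using (List; []; _∷_; _++_; _∷ʳ_; map)
open import Data.List.Properties using (map-++)
open import Data.List.NonEmpty as List⁺ using (List⁺; _∷_; toList; foldr₁)
open import Data.List.Relation.Unary.All as All using (All; []; _∷_)
open import Data.List.Relation.Unary.All.Properties using (∷ʳ⁺; ∷ʳ⁻)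
open import Data.List.Relation.Binary.Pointwise as Pointwise using ([]; _∷_; Pointwise-≡⇒≡)
open import Data.List.Relation.Binary.Permutation.Propositional as ↭ using (_↭_; ↭-sym)
open import Data.List.Relation.Binary.Permutation.Propositional.Properties as ↭ₚ using (All-resp-↭)
open import Relation.Binary.Lattice.Bundles using (Lattice)
import Relation.Binary.Lattice.Properties.JoinSemilattice as JoinSemilatticeProperties
import Relation.Binary.Reasoning.PartialOrder as PosetReasoning
open import Relation.Binary.PropositionalEquality
  using (_≡_; refl; sym; trans; cong; cong₂; subst; subst₂; isEquivalence; module ≡-Reasoning)

isAbelianGroupˡ : {A : Set} {_∙_ : A → A → A} {ε : A} {_⁻¹ : A → A} →
  (∀ x y z → (x ∙ y) ∙ z ≡ x ∙ (y ∙ z)) → (∀ x y → x ∙ y ≡ y ∙ x) →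
  (∀ x → ε ∙ x ≡ x) → (∀ x → (x ⁻¹) ∙ x ≡ ε) → IsAbelianGroup _≡_ _∙_ ε _⁻¹
isAbelianGroupˡ {_∙_ = _∙_} {_⁻¹ = _⁻¹} assoc comm identityˡ inverseˡ = record
  { isGroup = record
    { isMonoid = record
      { isSemigroup = record
        { isMagma = record { isEquivalence = isEquivalence ; ∙-cong = cong₂ _∙_ }
        ; assoc = assoc }
      ; identity = comm∧idˡ⇒id comm identityˡ }
    ; inverse = comm∧invˡ⇒inv comm inverseˡ
    ; ⁻¹-cong = cong _⁻¹ }
  ; comm = comm }

module RealFieldProperties (F : RealField) where
  open RealField F

  ring : Ring 0ℓ 0ℓ
  ring = record
    { isRing = record
      { +-isAbelianGroup = isAbelianGroupˡ +-assoc +-comm +-identityˡ +-inverseˡ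
      ; *-cong = cong₂ _*_
      ; *-assoc = *-assoc
      ; *-identity = comm∧idˡ⇒id *-comm *-identityˡ
      ; distrib = distribˡ , comm∧distrˡ⇒distrʳ *-comm distribˡ } }

  open RingProperties ring public
  open Ring ring public using (-‿inverseʳ; *-identityʳ)

  x≤y⇒0≤y-x : ∀ {x y} → x ≤ y → 0r ≤ y + - x
  x≤y⇒0≤y-x {x} {y} x≤y = subst (_≤ y + - x) (-‿inverseʳ x) (+-mono-≤ (- x) x≤y)

  x+[y-x]≡y : ∀ x y → x + (y + - x) ≡ y
  x+[y-x]≡y x y = trans (sym (+-assoc x y (- x))) (xyx⁻¹≈y x y)

  0≤x*x : ∀ x → 0r ≤ x * x
  0≤x*x x with ≤-total 0r x
  ... | inj₁ 0≤x = *-nonneg 0≤x 0≤x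
  ... | inj₂ x≤0 = subst (0r ≤_) -x*-x≡x*x (*-nonneg 0≤-x 0≤-x)
    where
    0≤-x : 0r ≤ - x
    0≤-x = subst (0r ≤_) (+-identityˡ (- x)) (x≤y⇒0≤y-x x≤0)
    -x*-x≡x*x : - x * - x ≡ x * x
    -x*-x≡x*x = trans (sym (-‿distribˡ-* x (- x)))
                  (trans (cong -_ (sym (-‿distribʳ-* x x))) (-‿involutive (x * x)))

  0≤x+y : ∀ {x y} → 0r ≤ x → 0r ≤ y → 0r ≤ x + y
  0≤x+y {x} {y} 0≤x 0≤y = ≤-trans 0≤y (subst (_≤ x + y) (+-identityˡ y) (+-mono-≤ y 0≤x))

  0<x+y : ∀ {x y} → 0r < x → 0r ≤ y → 0r < (x + y)
  0<x+y {x} {y} (0≤x , 0≢x) 0≤y = 0≤x+y 0≤x 0≤y , λ 0≡x+y → 0≢x (≤-antisym 0≤x (x≤0 0≡x+y))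
    where
    x≤0 : 0r ≡ x + y → x ≤ 0r
    x≤0 0≡x+y = subst₂ _≤_ (+-identityˡ x) (trans (+-comm y x) (sym 0≡x+y)) (+-mono-≤ x 0≤y)

  0≤val : (r : R>0) → 0r ≤ val r
  0≤val (_ , 0≤r , _) = 0≤r

  _⁻¹ : R>0 → R
  (r , _ , 0≢r) ⁻¹ = inv r (λ r≡0 → 0≢r (sym r≡0))

  ⁻¹-inverseˡ : (r : R>0) → r ⁻¹ * val r ≡ 1r
  ⁻¹-inverseˡ (r , _ , 0≢r) = *-inverseˡ r (λ r≡0 → 0≢r (sym r≡0))

  ⁻¹-inverseʳ : (r : R>0) → val r * r ⁻¹ ≡ 1r
  ⁻¹-inverseʳ r = trans (*-comm (val r) (r ⁻¹)) (⁻¹-inverseˡ r)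

  -- r⁻¹ = r⁻¹ r⁻¹ r is a square times a nonnegative number.
  0≤⁻¹ : (r : R>0) → 0r ≤ r ⁻¹
  0≤⁻¹ r = subst (0r ≤_) r⁻¹r⁻¹r≡r⁻¹ (*-nonneg (0≤x*x (r ⁻¹)) (0≤val r))
    where
    r⁻¹r⁻¹r≡r⁻¹ : (r ⁻¹ * r ⁻¹) * val r ≡ r ⁻¹
    r⁻¹r⁻¹r≡r⁻¹ = trans (*-assoc _ _ _) (trans (cong (r ⁻¹ *_) (⁻¹-inverseˡ r)) (*-identityʳ (r ⁻¹)))

module ModalRieszSpaceProperties {F : RealField} (M : ModalRiesz F) where
  module ℝ = RealField F
  open ℝ using (R>0; val; 0r; 1r) renaming (_+_ to _+ᵣ_; -_ to -ᵣ_; _≤_ to _≤ᵣ_)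
  open RealFieldProperties F using (_⁻¹; 0≤⁻¹; ⁻¹-inverseˡ; ⁻¹-inverseʳ; 0≤val; x≤y⇒0≤y-x; x+[y-x]≡y)
  open ModalRiesz M

  +-abelianGroup : AbelianGroup 0ℓ 0ℓ
  +-abelianGroup = record
    { isAbelianGroup = isAbelianGroupˡ +-assoc +-comm +-identityˡ +-inverseˡ }

  open AbelianGroupProperties +-abelianGroup public
  open CommutativeSemigroupProperties (AbelianGroup.commutativeSemigroup +-abelianGroup) public
    using (x∙yz≈y∙xz)
  open AbelianGroup +-abelianGroup public using (identityʳ; inverseʳ)

  ⊑-lattice : Lattice 0ℓ 0ℓ 0ℓ
  ⊑-lattice = record
    { isLattice = record
      { isPartialOrder = record
        { isPreorder = record
          { isEquivalence = isEquivalence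
          ; reflexive = λ { refl → ⊑-refl _ }
          ; trans = ⊑-trans }
        ; antisym = ⊑-antisym }
      ; supremum = λ a b → ⊔-upperˡ a b , ⊔-upperʳ a b , λ _ → ⊔-least
      ; infimum = λ a b → ⊓-lowerˡ a b , ⊓-lowerʳ a b , λ _ → ⊓-greatest } }

  open JoinSemilatticeProperties (Lattice.joinSemilattice ⊑-lattice) using (∨-monotonic)
  module ⊑-Reasoning = PosetReasoning (Lattice.poset ⊑-lattice)

  open Lattice ⊑-lattice public using () renaming (reflexive to ≡⇒⊑)

  ·-zeroˡ : ∀ a → 0r · a ≡ 𝟘
  ·-zeroˡ a = identityˡ-unique (0r · a) (0r · a)
    (trans (sym (·-distrib-+ᵣ 0r 0r a)) (cong (_· a) (ℝ.+-identityˡ 0r)))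

  ·-zeroʳ : ∀ r → r · 𝟘 ≡ 𝟘
  ·-zeroʳ r = identityˡ-unique (r · 𝟘) (r · 𝟘)
    (trans (sym (·-distrib-+ᵥ r 𝟘 𝟘)) (cong (r ·_) (+-identityˡ 𝟘)))

  ·-negˡ : ∀ r a → (-ᵣ r) · a ≡ - (r · a)
  ·-negˡ r a = inverseˡ-unique ((-ᵣ r) · a) (r · a)
    (trans (sym (·-distrib-+ᵣ (-ᵣ r) r a)) (trans (cong (_· a) (ℝ.+-inverseˡ r)) (·-zeroˡ a)))

  ·-negʳ : ∀ r a → r · (- a) ≡ - (r · a)
  ·-negʳ r a = inverseˡ-unique (r · (- a)) (r · a)
    (trans (sym (·-distrib-+ᵥ r (- a) a)) (trans (cong (r ·_) (+-inverseˡ a)) (·-zeroʳ r)))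

  ⁻¹·-cancel : (r : R>0) → ∀ a → r ⁻¹ · (val r · a) ≡ a
  ⁻¹·-cancel r a = trans (·-assoc _ _ a) (trans (cong (_· a) (⁻¹-inverseˡ r)) (·-identity a))

  ·⁻¹-cancel : (r : R>0) → ∀ a → val r · (r ⁻¹ · a) ≡ a
  ·⁻¹-cancel r a = trans (·-assoc _ _ a) (trans (cong (_· a) (⁻¹-inverseʳ r)) (·-identity a))

  +-monoʳ-⊑ : ∀ c {a b} → a ⊑ b → c + a ⊑ c + b
  +-monoʳ-⊑ c {a} {b} a⊑b = subst₂ _⊑_ (+-comm a c) (+-comm b c) (+-mono c a⊑b)

  +-mono-⊑ : ∀ {a b c d} → a ⊑ b → c ⊑ d → a + c ⊑ b + d
  +-mono-⊑ {b = b} {c} a⊑b c⊑d = ⊑-trans (+-mono c a⊑b) (+-monoʳ-⊑ b c⊑d)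

  +-cancelʳ-⊑ : ∀ c {a b} → a + c ⊑ b + c → a ⊑ b
  +-cancelʳ-⊑ c {a} {b} p =
    subst₂ _⊑_ (//-rightDividesʳ c a) (//-rightDividesʳ c b) (+-mono (- c) p)

  x⊑x+y : ∀ x {y} → 𝟘 ⊑ y → x ⊑ x + y
  x⊑x+y x 𝟘⊑y = subst (_⊑ x + _) (identityʳ x) (+-monoʳ-⊑ x 𝟘⊑y)

  y⊑x+y : ∀ {x} y → 𝟘 ⊑ x → y ⊑ x + y
  y⊑x+y {x} y 𝟘⊑x = subst (y ⊑_) (+-comm y x) (x⊑x+y y 𝟘⊑x)

  𝟘⊑x+y : ∀ {x y} → 𝟘 ⊑ x → 𝟘 ⊑ y → 𝟘 ⊑ x + y
  𝟘⊑x+y 𝟘⊑x 𝟘⊑y = subst (_⊑ _) (+-identityˡ 𝟘) (+-mono-⊑ 𝟘⊑x 𝟘⊑y)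

  -‿antitone : ∀ {a b} → a ⊑ b → - b ⊑ - a
  -‿antitone {a} {b} a⊑b = subst₂ _⊑_ (\\-leftDividesˡ a (- b)) -a≡b-a-b (+-mono (- a + - b) a⊑b)
    where
    -a≡b-a-b : b + (- a + - b) ≡ - a
    -a≡b-a-b = trans (x∙yz≈y∙xz b (- a) (- b)) (trans (cong (- a +_) (inverseʳ b)) (identityʳ (- a)))

  𝟘⊑a⇒-a⊑𝟘 : ∀ {a} → 𝟘 ⊑ a → - a ⊑ 𝟘
  𝟘⊑a⇒-a⊑𝟘 𝟘⊑a = subst (_ ⊑_) ε⁻¹≈ε (-‿antitone 𝟘⊑a)

  -a⊑𝟘⇒𝟘⊑a : ∀ {a} → - a ⊑ 𝟘 → 𝟘 ⊑ a
  -a⊑𝟘⇒𝟘⊑a {a} -a⊑𝟘 = subst₂ _⊑_ ε⁻¹≈ε (⁻¹-involutive a) (-‿antitone -a⊑𝟘)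

  ·-nonneg : ∀ {r a} → 0r ≤ᵣ r → 𝟘 ⊑ a → 𝟘 ⊑ r · a
  ·-nonneg {r} 0≤r 𝟘⊑a = subst (_⊑ _) (·-zeroʳ r) (·-mono r 0≤r 𝟘⊑a)

  ·-monoˡ-⊑ : ∀ {r s a} → r ≤ᵣ s → 𝟘 ⊑ a → r · a ⊑ s · a
  ·-monoˡ-⊑ {r} {s} {a} r≤s 𝟘⊑a = subst₂ _⊑_ (identityʳ (r · a)) r+[s-r]≡s
    (+-monoʳ-⊑ (r · a) (·-nonneg (x≤y⇒0≤y-x r≤s) 𝟘⊑a))
    where
    r+[s-r]≡s : r · a + (s +ᵣ -ᵣ r) · a ≡ s · a
    r+[s-r]≡s = trans (sym (·-distrib-+ᵣ r _ a)) (cong (_· a) (x+[y-x]≡y r s))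

  module _ {f g : V → V} (f-mono : ∀ {a b} → a ⊑ b → f a ⊑ f b) (g-mono : ∀ {a b} → a ⊑ b → g a ⊑ g b)
           (g∘f : ∀ a → g (f a) ≡ a) (f∘g : ∀ a → f (g a) ≡ a) where

    automorphism-⊔ : ∀ a b → f (a ⊔ b) ≡ f a ⊔ f b
    automorphism-⊔ a b = ⊑-antisym
      (subst (f (a ⊔ b) ⊑_) (f∘g _) (f-mono (⊔-least (below a (⊔-upperˡ _ _)) (below b (⊔-upperʳ _ _)))))
      (⊔-least (f-mono (⊔-upperˡ a b)) (f-mono (⊔-upperʳ a b)))
      where
      below : ∀ x → f x ⊑ f a ⊔ f b → x ⊑ g (f a ⊔ f b)
      below x fx⊑ = subst (_⊑ _) (g∘f x) (g-mono fx⊑)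

    automorphism-⊓ : ∀ a b → f (a ⊓ b) ≡ f a ⊓ f b
    automorphism-⊓ a b = ⊑-antisym
      (⊓-greatest (f-mono (⊓-lowerˡ a b)) (f-mono (⊓-lowerʳ a b)))
      (subst (_⊑ f (a ⊓ b)) (f∘g _) (f-mono (⊓-greatest (above a (⊓-lowerˡ _ _)) (above b (⊓-lowerʳ _ _)))))
      where
      above : ∀ x → f a ⊓ f b ⊑ f x → g (f a ⊓ f b) ⊑ x
      above x ⊑fx = subst (_ ⊑_) (g∘f x) (g-mono ⊑fx)

  +-distribˡ-⊔ : ∀ c a b → c + (a ⊔ b) ≡ (c + a) ⊔ (c + b)
  +-distribˡ-⊔ c = automorphism-⊔ (+-monoʳ-⊑ c) (+-monoʳ-⊑ (- c)) (\\-leftDividesʳ c) (\\-leftDividesˡ c)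

  +-distribˡ-⊓ : ∀ c a b → c + (a ⊓ b) ≡ (c + a) ⊓ (c + b)
  +-distribˡ-⊓ c = automorphism-⊓ (+-monoʳ-⊑ c) (+-monoʳ-⊑ (- c)) (\\-leftDividesʳ c) (\\-leftDividesˡ c)

  ·-distribˡ-⊔ : (r : R>0) → ∀ a b → val r · (a ⊔ b) ≡ (val r · a) ⊔ (val r · b)
  ·-distribˡ-⊔ r = automorphism-⊔ (·-mono _ (0≤val r)) (·-mono _ (0≤⁻¹ r)) (⁻¹·-cancel r) (·⁻¹-cancel r)

  ·-distribˡ-⊓ : (r : R>0) → ∀ a b → val r · (a ⊓ b) ≡ (val r · a) ⊓ (val r · b)
  ·-distribˡ-⊓ r = automorphism-⊓ (·-mono _ (0≤val r)) (·-mono _ (0≤⁻¹ r)) (⁻¹·-cancel r) (·⁻¹-cancel r)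

  -‿⊔ : ∀ a b → - (a ⊔ b) ≡ (- a) ⊓ (- b)
  -‿⊔ a b = ⊑-antisym
    (⊓-greatest (-‿antitone (⊔-upperˡ a b)) (-‿antitone (⊔-upperʳ a b)))
    (subst (_⊑ _) (⁻¹-involutive _) (-‿antitone (⊔-least (flip (⊓-lowerˡ _ _)) (flip (⊓-lowerʳ _ _)))))
    where
    flip : ∀ {x y} → y ⊑ - x → x ⊑ - y
    flip {x} y⊑-x = subst (_⊑ _) (⁻¹-involutive x) (-‿antitone y⊑-x)

  -‿⊓ : ∀ a b → - (a ⊓ b) ≡ (- a) ⊔ (- b)
  -‿⊓ a b = begin
    - (a ⊓ b)                 ≡⟨ cong₂ (λ x y → - (x ⊓ y)) (⁻¹-involutive a) (⁻¹-involutive b) ⟨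
    - ((- (- a)) ⊓ (- (- b))) ≡⟨ cong -_ (-‿⊔ (- a) (- b)) ⟨
    - (- ((- a) ⊔ (- b)))     ≡⟨ ⁻¹-involutive _ ⟩
    (- a) ⊔ (- b)             ∎
    where open ≡-Reasoning

  infix 25 _⁻
  _⁻ : V → V
  a ⁻ = 𝟘 ⊔ (- a)

  ⁻-nonneg : ∀ a → 𝟘 ⊑ a ⁻
  ⁻-nonneg a = ⊔-upperˡ 𝟘 (- a)

  ⁻-antitone : ∀ {a b} → a ⊑ b → b ⁻ ⊑ a ⁻
  ⁻-antitone a⊑b = ∨-monotonic (⊑-refl 𝟘) (-‿antitone a⊑b)

  𝟘⊑a⇒a⁻⊑𝟘 : ∀ {a} → 𝟘 ⊑ a → a ⁻ ⊑ 𝟘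
  𝟘⊑a⇒a⁻⊑𝟘 𝟘⊑a = ⊔-least (⊑-refl 𝟘) (𝟘⊑a⇒-a⊑𝟘 𝟘⊑a)

  a⁻⊑𝟘⇒𝟘⊑a : ∀ {a} → a ⁻ ⊑ 𝟘 → 𝟘 ⊑ a
  a⁻⊑𝟘⇒𝟘⊑a a⁻⊑𝟘 = -a⊑𝟘⇒𝟘⊑a (⊑-trans (⊔-upperʳ _ _) a⁻⊑𝟘)

  ·-⁻ : (r : R>0) → ∀ a → val r · a ⁻ ≡ (val r · a) ⁻
  ·-⁻ r a = trans (·-distribˡ-⊔ r 𝟘 (- a)) (cong₂ _⊔_ (·-zeroʳ (val r)) (·-negʳ (val r) a))

  ⁻-+ : ∀ a b → (a + b) ⁻ ⊑ a ⁻ + b ⁻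
  ⁻-+ a b = ⊔-least (𝟘⊑x+y (⁻-nonneg a) (⁻-nonneg b))
    (subst (_⊑ a ⁻ + b ⁻) (⁻¹-∙-comm a b) (+-mono-⊑ (⊔-upperʳ 𝟘 (- a)) (⊔-upperʳ 𝟘 (- b))))

  ⁻-⊓ : ∀ a b → (a ⊓ b) ⁻ ⊑ a ⁻ + b ⁻
  ⁻-⊓ a b = ⊔-least (𝟘⊑x+y (⁻-nonneg a) (⁻-nonneg b)) (subst (_⊑ a ⁻ + b ⁻) (sym (-‿⊓ a b))
    (⊔-least (⊑-trans (⊔-upperʳ 𝟘 (- a)) (x⊑x+y (a ⁻) (⁻-nonneg b)))
             (⊑-trans (⊔-upperʳ 𝟘 (- b)) (y⊑x+y (b ⁻) (⁻-nonneg a)))))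

  x⊓y+x⊔y⊑x+y : ∀ x y → (x ⊓ y) + (x ⊔ y) ⊑ x + y
  x⊓y+x⊔y⊑x+y x y = subst (_⊑ x + y) (sym (+-distribˡ-⊔ (x ⊓ y) x y))
    (⊔-least (subst ((x ⊓ y) + x ⊑_) (+-comm y x) (+-mono x (⊓-lowerʳ x y))) (+-mono y (⊓-lowerˡ x y)))

  ⁻+⁻⊑⁻⊔⁻+[a+b]⁻ : ∀ a b → a ⁻ + b ⁻ ⊑ (a ⁻ ⊔ b ⁻) + (a + b) ⁻
  ⁻+⁻⊑⁻⊔⁻+[a+b]⁻ a b = begin
    a ⁻ + b ⁻                              ≡⟨ +-comm (a ⁻) (b ⁻) ⟩
    b ⁻ + (𝟘 ⊔ (- a))                      ≡⟨ +-distribˡ-⊔ (b ⁻) 𝟘 (- a) ⟩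
    (b ⁻ + 𝟘) ⊔ (b ⁻ + - a)                ≡⟨ cong₂ _⊔_ (identityʳ (b ⁻)) (+-comm (b ⁻) (- a)) ⟩
    b ⁻ ⊔ (- a + (𝟘 ⊔ (- b)))              ≡⟨ cong (b ⁻ ⊔_) (+-distribˡ-⊔ (- a) 𝟘 (- b)) ⟩
    b ⁻ ⊔ ((- a + 𝟘) ⊔ (- a + - b))        ≡⟨ cong (λ x → b ⁻ ⊔ (x ⊔ (- a + - b))) (identityʳ (- a)) ⟩
    b ⁻ ⊔ ((- a) ⊔ (- a + - b))            ≤⟨ ⊔-least (⊑-trans (⊔-upperʳ _ _) W⊑T)
                                                (⊔-least (⊑-trans (⊑-trans (⊔-upperʳ _ _) (⊔-upperˡ _ _)) W⊑T) -a-b⊑T) ⟩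
    (a ⁻ ⊔ b ⁻) + (a + b) ⁻                ∎
    where
    open ⊑-Reasoning
    W⊑T : a ⁻ ⊔ b ⁻ ⊑ (a ⁻ ⊔ b ⁻) + (a + b) ⁻
    W⊑T = x⊑x+y _ (⁻-nonneg (a + b))
    -a-b⊑T : - a + - b ⊑ (a ⁻ ⊔ b ⁻) + (a + b) ⁻
    -a-b⊑T = subst (_⊑ (a ⁻ ⊔ b ⁻) + (a + b) ⁻) (sym (⁻¹-∙-comm a b))
      (⊑-trans (⊔-upperʳ 𝟘 _) (y⊑x+y _ (⊑-trans (⁻-nonneg a) (⊔-upperˡ _ _))))

  -- Cancel a ⁻ ⊔ b ⁻ in  (a ⁻ ⊓ b ⁻) + (a ⁻ ⊔ b ⁻) ⊑ a ⁻ + b ⁻ ⊑ (a + b) ⁻ + (a ⁻ ⊔ b ⁻).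
  ⁻⊓⁻⊑[a+b]⁻ : ∀ a b → a ⁻ ⊓ b ⁻ ⊑ (a + b) ⁻
  ⁻⊓⁻⊑[a+b]⁻ a b = +-cancelʳ-⊑ (a ⁻ ⊔ b ⁻)
    (⊑-trans (x⊓y+x⊔y⊑x+y (a ⁻) (b ⁻))
      (subst (a ⁻ + b ⁻ ⊑_) (+-comm _ _) (⁻+⁻⊑⁻⊔⁻+[a+b]⁻ a b)))

  ⊓-+-subdistrib : ∀ {x y z} → 𝟘 ⊑ x → 𝟘 ⊑ y → 𝟘 ⊑ z → x ⊓ (y + z) ⊑ (x ⊓ y) + (x ⊓ z)
  ⊓-+-subdistrib {x} {y} {z} 𝟘⊑x 𝟘⊑y 𝟘⊑z =
    subst (x ⊓ (y + z) ⊑_) (sym (+-distribˡ-⊓ (x ⊓ y) x z)) (⊓-greatest ⊑[x⊓y]+x ⊑[x⊓y]+z)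
    where
    L⊑x : x ⊓ (y + z) ⊑ x
    L⊑x = ⊓-lowerˡ x (y + z)
    ⊑[x⊓y]+x : x ⊓ (y + z) ⊑ (x ⊓ y) + x
    ⊑[x⊓y]+x = subst (x ⊓ (y + z) ⊑_) (trans (sym (+-distribˡ-⊓ x x y)) (+-comm x (x ⊓ y)))
      (⊓-greatest (⊑-trans L⊑x (x⊑x+y x 𝟘⊑x)) (⊑-trans L⊑x (x⊑x+y x 𝟘⊑y)))
    ⊑[x⊓y]+z : x ⊓ (y + z) ⊑ (x ⊓ y) + z
    ⊑[x⊓y]+z = subst (x ⊓ (y + z) ⊑_) (trans (sym (+-distribˡ-⊓ z x y)) (+-comm z (x ⊓ y)))
      (⊓-greatest (⊑-trans L⊑x (y⊑x+y x 𝟘⊑z)) (subst (x ⊓ (y + z) ⊑_) (+-comm y z) (⊓-lowerʳ x (y + z))))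

  ◇-+ : ∀ a b → ◇ (a + b) ≡ ◇ a + ◇ b
  ◇-+ a b = trans (cong ◇ (sym (cong₂ _+_ (·-identity a) (·-identity b))))
    (trans (◇-linear 1r 1r a b) (cong₂ _+_ (·-identity (◇ a)) (·-identity (◇ b))))

  ◇-· : ∀ r a → ◇ (r · a) ≡ r · ◇ a
  ◇-· r a = trans (cong ◇ (sym (trans (cong (r · a +_) (·-zeroˡ a)) (identityʳ (r · a)))))
    (trans (◇-linear r 0r a a) (trans (cong (r · ◇ a +_) (·-zeroˡ (◇ a))) (identityʳ (r · ◇ a))))

  ◇-𝟘 : ◇ 𝟘 ≡ 𝟘
  ◇-𝟘 = trans (cong ◇ (sym (·-zeroˡ 𝟘))) (trans (◇-· 0r 𝟘) (·-zeroˡ (◇ 𝟘)))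

  ◇-‿ : ∀ a → ◇ (- a) ≡ - ◇ a
  ◇-‿ a = inverseˡ-unique (◇ (- a)) (◇ a) (trans (sym (◇-+ (- a) a)) (trans (cong ◇ (+-inverseˡ a)) ◇-𝟘))

  ◇-nonneg : ∀ {a} → 𝟘 ⊑ a → 𝟘 ⊑ ◇ a
  ◇-nonneg {a} 𝟘⊑a = subst (λ x → 𝟘 ⊑ ◇ x) (⊑-antisym (⊔-least 𝟘⊑a (⊑-refl a)) (⊔-upperʳ 𝟘 a)) (◇-pos a)

  𝟘⊑a+d𝟙⇒𝟘⊑◇a+d𝟙 : ∀ {a d} → 0r ≤ᵣ d → 𝟘 ⊑ a + d · 𝟙 → 𝟘 ⊑ ◇ a + d · 𝟙
  𝟘⊑a+d𝟙⇒𝟘⊑◇a+d𝟙 {a} {d} 0≤d 𝟘⊑a+d𝟙 = begin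
    𝟘                   ≤⟨ ◇-nonneg 𝟘⊑a+d𝟙 ⟩
    ◇ (a + d · 𝟙)       ≡⟨ trans (◇-+ a (d · 𝟙)) (cong (◇ a +_) (◇-· d 𝟙)) ⟩
    ◇ a + d · ◇ 𝟙       ≤⟨ +-monoʳ-⊑ (◇ a) (·-mono d 0≤d ◇-𝟙) ⟩
    ◇ a + d · 𝟙         ∎
    where open ⊑-Reasoning

  -- Encodes 𝟘 ⊑ ⋁ us: as (⋁ us) ⁻ is the meet of the u ⁻, the join is nonnegative iff every
  -- nonnegative common lower bound of the u ⁻ vanishes. Quantifying over such bounds avoids forming the meet.
  NonnegJoin : List V → Set
  NonnegJoin us = ∀ m → 𝟘 ⊑ m → All (λ u → m ⊑ u ⁻) us → m ⊑ 𝟘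

  NonnegJoin-[_] : ∀ {u} → 𝟘 ⊑ u → NonnegJoin (u ∷ [])
  NonnegJoin-[ 𝟘⊑u ] m _ (m⊑u⁻ ∷ []) = ⊑-trans m⊑u⁻ (𝟘⊑a⇒a⁻⊑𝟘 𝟘⊑u)

  ⊑⋁ : ∀ u vs → All (_⊑ foldr₁ _⊔_ (u ∷ vs)) (u ∷ vs)
  ⊑⋁ u [] = ⊑-refl u ∷ []
  ⊑⋁ u (v ∷ vs) = ⊔-upperˡ _ _ ∷ All.map (λ w⊑ → ⊑-trans w⊑ (⊔-upperʳ _ _)) (⊑⋁ v vs)

  NonnegJoin⇒𝟘⊑⋁ : (us : List⁺ V) → NonnegJoin (toList us) → 𝟘 ⊑ foldr₁ _⊔_ us
  NonnegJoin⇒𝟘⊑⋁ (u ∷ vs) h = a⁻⊑𝟘⇒𝟘⊑a (h _ (⁻-nonneg _) (All.map ⁻-antitone (⊑⋁ u vs)))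

  NonnegJoin-resp-↭ : ∀ {us vs} → us ↭ vs → NonnegJoin us → NonnegJoin vs
  NonnegJoin-resp-↭ us↭vs h m 𝟘⊑m bounds = h m 𝟘⊑m (All-resp-↭ (↭-sym us↭vs) bounds)

  NonnegJoin-weaken : ∀ {us u} → NonnegJoin us → NonnegJoin (us ∷ʳ u)
  NonnegJoin-weaken h m 𝟘⊑m bounds = h m 𝟘⊑m (proj₁ (∷ʳ⁻ bounds))

  NonnegJoin-monoʳ : ∀ {us u v} → u ⊑ v → NonnegJoin (us ∷ʳ u) → NonnegJoin (us ∷ʳ v)
  NonnegJoin-monoʳ u⊑v h m 𝟘⊑m bounds with ∷ʳ⁻ bounds
  ... | bs , m⊑v⁻ = h m 𝟘⊑m (∷ʳ⁺ bs (⊑-trans m⊑v⁻ (⁻-antitone u⊑v)))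

  NonnegJoin-contract : ∀ {us u v w} → u ⊑ w → v ⊑ w → NonnegJoin (us ∷ʳ u ∷ʳ v) → NonnegJoin (us ∷ʳ w)
  NonnegJoin-contract u⊑w v⊑w h m 𝟘⊑m bounds with ∷ʳ⁻ bounds
  ... | bs , m⊑w⁻ = h m 𝟘⊑m (∷ʳ⁺ (∷ʳ⁺ bs (⊑-trans m⊑w⁻ (⁻-antitone u⊑w))) (⊑-trans m⊑w⁻ (⁻-antitone v⊑w)))

  NonnegJoin-split : ∀ {us u v w} → w ⊑ u + v → NonnegJoin (us ∷ʳ w) → NonnegJoin (us ∷ʳ u ∷ʳ v)
  NonnegJoin-split {u = u} {v} w⊑u+v h m 𝟘⊑m bounds with ∷ʳ⁻ bounds
  ... | bs′ , m⊑v⁻ with ∷ʳ⁻ bs′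
  ... | bs , m⊑u⁻ = h m 𝟘⊑m (∷ʳ⁺ bs (⊑-trans (⊓-greatest m⊑u⁻ m⊑v⁻)
                                      (⊑-trans (⁻⊓⁻⊑[a+b]⁻ u v) (⁻-antitone w⊑u+v))))

  NonnegJoin-combine : ∀ {us u v w} → w ⁻ ⊑ u ⁻ + v ⁻ →
                       NonnegJoin (us ∷ʳ u) → NonnegJoin (us ∷ʳ v) → NonnegJoin (us ∷ʳ w)
  NonnegJoin-combine {us} {u} {v} w⁻⊑ hu hv m 𝟘⊑m bounds with ∷ʳ⁻ bounds
  ... | bs , m⊑w⁻ = begin
    m                         ≤⟨ ⊓-greatest (⊑-refl m) (⊑-trans m⊑w⁻ w⁻⊑) ⟩
    m ⊓ (u ⁻ + v ⁻)           ≤⟨ ⊓-+-subdistrib 𝟘⊑m (⁻-nonneg u) (⁻-nonneg v) ⟩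
    (m ⊓ u ⁻) + (m ⊓ v ⁻)     ≤⟨ +-mono-⊑ (meet-⊑𝟘 hu) (meet-⊑𝟘 hv) ⟩
    𝟘 + 𝟘                     ≡⟨ +-identityˡ 𝟘 ⟩
    𝟘                         ∎
    where
    open ⊑-Reasoning
    meet-⊑𝟘 : ∀ {x} → NonnegJoin (us ∷ʳ x) → m ⊓ x ⁻ ⊑ 𝟘
    meet-⊑𝟘 {x} h = h (m ⊓ x ⁻) (⊓-greatest 𝟘⊑m (⁻-nonneg x))
      (∷ʳ⁺ (All.map (⊑-trans (⊓-lowerˡ m (x ⁻))) bs) (⊓-lowerʳ m (x ⁻)))

  NonnegJoin-+ : ∀ {us u v w} → u + v ⊑ w → NonnegJoin (us ∷ʳ u) → NonnegJoin (us ∷ʳ v) → NonnegJoin (us ∷ʳ w)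
  NonnegJoin-+ {u = u} {v} u+v⊑w = NonnegJoin-combine (⊑-trans (⁻-antitone u+v⊑w) (⁻-+ u v))

  NonnegJoin-⊓ : ∀ {us u v w} → u ⊓ v ⊑ w → NonnegJoin (us ∷ʳ u) → NonnegJoin (us ∷ʳ v) → NonnegJoin (us ∷ʳ w)
  NonnegJoin-⊓ {u = u} {v} u⊓v⊑w = NonnegJoin-combine (⊑-trans (⁻-antitone u⊓v⊑w) (⁻-⊓ u v))

  ru⁻⊑w⁻ : ∀ (r : R>0) {u w} → w ⊑ val r · u → val r · u ⁻ ⊑ w ⁻
  ru⁻⊑w⁻ r {u} w⊑ru = subst (_⊑ _) (sym (·-⁻ r u)) (⁻-antitone w⊑ru)

  NonnegJoin-unscale : ∀ {us u w} (r : R>0) → w ⊑ val r · u → NonnegJoin (us ∷ʳ w) → NonnegJoin (us ∷ʳ u)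
  NonnegJoin-unscale {us} {u} {w} r w⊑ru h m 𝟘⊑m bounds with ∷ʳ⁻ bounds | ℝ.≤-total 1r (val r)
  ... | bs , m⊑u⁻ | inj₁ 1≤r = h m 𝟘⊑m (∷ʳ⁺ bs (⊑-trans m⊑u⁻ (⊑-trans u⁻⊑ru⁻ (ru⁻⊑w⁻ r w⊑ru))))
    where
    u⁻⊑ru⁻ : u ⁻ ⊑ val r · u ⁻
    u⁻⊑ru⁻ = subst (_⊑ val r · u ⁻) (·-identity (u ⁻)) (·-monoˡ-⊑ 1≤r (⁻-nonneg u))
  ... | bs , m⊑u⁻ | inj₂ r≤1 = subst₂ _⊑_ (⁻¹·-cancel r m) (·-zeroʳ (r ⁻¹)) (·-mono (r ⁻¹) (0≤⁻¹ r) rm⊑𝟘)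
    where
    rm⊑m : val r · m ⊑ m
    rm⊑m = subst (val r · m ⊑_) (·-identity m) (·-monoˡ-⊑ r≤1 𝟘⊑m)
    rm⊑𝟘 : val r · m ⊑ 𝟘
    rm⊑𝟘 = h (val r · m) (·-nonneg (0≤val r) 𝟘⊑m)
      (∷ʳ⁺ (All.map (⊑-trans rm⊑m) bs) (⊑-trans (·-mono (val r) (0≤val r) m⊑u⁻) (ru⁻⊑w⁻ r w⊑ru)))

module Soundness {F : RealField} (𝕍 : ModalRiesz F) (σ : ℕ → ModalRiesz.V 𝕍) where
  open RealFieldProperties F using (0≤x+y; 0<x+y; 0≤val; x≤y⇒0≤y-x)
  open ModalRiesz 𝕍
  open ModalRieszSpaceProperties 𝕍
  open ℝ using (R>0; val; 0r) renaming (_+_ to _+ᵣ_; -_ to -ᵣ_; _≤_ to _≤ᵣ_)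
  open HMR F
  open Sem 𝕍 σ

  Σ⃗-nonneg : ∀ rs → 0r ≤ᵣ Σ⃗ rs
  Σ⃗-nonneg [] = ℝ.≤-refl 0r
  Σ⃗-nonneg (r ∷ rs) = 0≤x+y (0≤val r) (Σ⃗-nonneg rs)

  Σ⃗⁺ : R>0 → List R>0 → R>0
  Σ⃗⁺ r rs = Σ⃗ (r ∷ rs) , 0<x+y (proj₂ r) (Σ⃗-nonneg rs)

  ⟦neg⟧ : ∀ A → ⟦ neg A ⟧ ≡ - ⟦ A ⟧
  ⟦neg⟧ (var x) = refl
  ⟦neg⟧ (covar x) = sym (⁻¹-involutive (σ x))
  ⟦neg⟧ zero = sym ε⁻¹≈ε
  ⟦neg⟧ one = refl
  ⟦neg⟧ coone = sym (⁻¹-involutive 𝟙)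
  ⟦neg⟧ (A ⊕ B) = trans (cong₂ _+_ (⟦neg⟧ A) (⟦neg⟧ B)) (⁻¹-∙-comm ⟦ A ⟧ ⟦ B ⟧)
  ⟦neg⟧ (r ⊗ A) = trans (cong (val r ·_) (⟦neg⟧ A)) (·-negʳ (val r) ⟦ A ⟧)
  ⟦neg⟧ (A ⊔ₜ B) = trans (cong₂ _⊓_ (⟦neg⟧ A) (⟦neg⟧ B)) (sym (-‿⊔ ⟦ A ⟧ ⟦ B ⟧))
  ⟦neg⟧ (A ⊓ₜ B) = trans (cong₂ _⊔_ (⟦neg⟧ A) (⟦neg⟧ B)) (sym (-‿⊓ ⟦ A ⟧ ⟦ B ⟧))
  ⟦neg⟧ (◇ₜ A) = trans (cong ◇ (⟦neg⟧ A)) (◇-‿ ⟦ A ⟧)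

  ⟦++⟧ˢ : ∀ Γ Δ → ⟦ Γ ++ Δ ⟧ˢ ≡ ⟦ Γ ⟧ˢ + ⟦ Δ ⟧ˢ
  ⟦++⟧ˢ [] Δ = sym (+-identityˡ ⟦ Δ ⟧ˢ)
  ⟦++⟧ˢ ((r , A) ∷ Γ) Δ = trans (cong (val r · ⟦ A ⟧ +_) (⟦++⟧ˢ Γ Δ)) (sym (+-assoc _ _ _))

  ⟦∙⟧ˢ : ∀ rs A → ⟦ rs ∙ A ⟧ˢ ≡ Σ⃗ rs · ⟦ A ⟧
  ⟦∙⟧ˢ [] A = sym (·-zeroˡ ⟦ A ⟧)
  ⟦∙⟧ˢ (r ∷ rs) A = trans (cong (val r · ⟦ A ⟧ +_) (⟦∙⟧ˢ rs A)) (sym (·-distrib-+ᵣ _ _ _))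

  ⟦∙++∙⟧ˢ : ∀ rs A ss B → ⟦ rs ∙ A ++ ss ∙ B ⟧ˢ ≡ Σ⃗ rs · ⟦ A ⟧ + Σ⃗ ss · ⟦ B ⟧
  ⟦∙++∙⟧ˢ rs A ss B = trans (⟦++⟧ˢ (rs ∙ A) (ss ∙ B)) (cong₂ _+_ (⟦∙⟧ˢ rs A) (⟦∙⟧ˢ ss B))

  ⟦◇Seq⟧ˢ : ∀ Γ → ⟦ ◇Seq Γ ⟧ˢ ≡ ◇ ⟦ Γ ⟧ˢ
  ⟦◇Seq⟧ˢ [] = sym ◇-𝟘
  ⟦◇Seq⟧ˢ ((r , A) ∷ Γ) = trans (cong (val r · ◇ ⟦ A ⟧ +_) (⟦◇Seq⟧ˢ Γ))
    (sym (trans (◇-+ _ _) (cong (_+ ◇ ⟦ Γ ⟧ˢ) (◇-· _ _))))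

  ⟦Scaled⟧ˢ : ∀ r {Δ Γ} → Scaled r Δ Γ → ⟦ Δ ⟧ˢ ≡ val r · ⟦ Γ ⟧ˢ
  ⟦Scaled⟧ˢ r [] = sym (·-zeroʳ (val r))
  ⟦Scaled⟧ˢ r {(t , A) ∷ Δ} {(u , .A) ∷ Γ} ((t≡ru , refl) ∷ Δ≡rΓ) =
    trans (cong₂ _+_ (trans (cong (_· ⟦ A ⟧) t≡ru) (sym (·-assoc _ _ _))) (⟦Scaled⟧ˢ r Δ≡rΓ))
          (sym (·-distrib-+ᵥ _ _ _))

  ⟦ScaledW⟧ˢ : ∀ {s ts rs} A → ScaledW s ts rs → ⟦ ts ∙ A ⟧ˢ ≡ ⟦ rs ∙ (s ⊗ A) ⟧ˢ
  ⟦ScaledW⟧ˢ A [] = refl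
  ⟦ScaledW⟧ˢ A (t≡sr ∷ ts≡srs) =
    cong₂ _+_ (trans (cong (_· ⟦ A ⟧) (trans t≡sr (ℝ.*-comm _ _))) (sym (·-assoc _ _ _))) (⟦ScaledW⟧ˢ A ts≡srs)

  ⟦⟧ˢ-resp-↭ : ∀ {Γ Δ} → Γ ↭ Δ → ⟦ Γ ⟧ˢ ≡ ⟦ Δ ⟧ˢ
  ⟦⟧ˢ-resp-↭ ↭.refl = refl
  ⟦⟧ˢ-resp-↭ (↭.prep (r , A) p) = cong (val r · ⟦ A ⟧ +_) (⟦⟧ˢ-resp-↭ p)
  ⟦⟧ˢ-resp-↭ (↭.swap (r , A) (s , B) p) =
    trans (cong (λ x → val r · ⟦ A ⟧ + (val s · ⟦ B ⟧ + x)) (⟦⟧ˢ-resp-↭ p)) (x∙yz≈y∙xz _ _ _)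
  ⟦⟧ˢ-resp-↭ (↭.trans p q) = trans (⟦⟧ˢ-resp-↭ p) (⟦⟧ˢ-resp-↭ q)

  ⟦++⟧ˢ-monoʳ : ∀ Γ {Δ Δ′} → ⟦ Δ ⟧ˢ ⊑ ⟦ Δ′ ⟧ˢ → ⟦ Γ ++ Δ ⟧ˢ ⊑ ⟦ Γ ++ Δ′ ⟧ˢ
  ⟦++⟧ˢ-monoʳ Γ {Δ} {Δ′} p = subst₂ _⊑_ (sym (⟦++⟧ˢ Γ Δ)) (sym (⟦++⟧ˢ Γ Δ′)) (+-monoʳ-⊑ ⟦ Γ ⟧ˢ p)

  ⟦++⟧ˢ-identityʳ : ∀ Γ {Δ} → ⟦ Δ ⟧ˢ ≡ 𝟘 → ⟦ Γ ++ Δ ⟧ˢ ≡ ⟦ Γ ⟧ˢ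
  ⟦++⟧ˢ-identityʳ Γ {Δ} Δ≡𝟘 = trans (⟦++⟧ˢ Γ Δ) (trans (cong (⟦ Γ ⟧ˢ +_) Δ≡𝟘) (identityʳ ⟦ Γ ⟧ˢ))

  ⟦⟧ˢ⊑⟦++⟧ˢ : ∀ Γ {Δ} → 𝟘 ⊑ ⟦ Δ ⟧ˢ → ⟦ Γ ⟧ˢ ⊑ ⟦ Γ ++ Δ ⟧ˢ
  ⟦⟧ˢ⊑⟦++⟧ˢ Γ {Δ} 𝟘⊑Δ = subst (⟦ Γ ⟧ˢ ⊑_) (sym (⟦++⟧ˢ Γ Δ)) (x⊑x+y ⟦ Γ ⟧ˢ 𝟘⊑Δ)

  ⟦∙⟧ˢ-mono : ∀ rs {A B} → ⟦ A ⟧ ⊑ ⟦ B ⟧ → ⟦ rs ∙ A ⟧ˢ ⊑ ⟦ rs ∙ B ⟧ˢ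
  ⟦∙⟧ˢ-mono rs {A} {B} A⊑B = subst₂ _⊑_ (sym (⟦∙⟧ˢ rs A)) (sym (⟦∙⟧ˢ rs B)) (·-mono _ (Σ⃗-nonneg rs) A⊑B)

  ⟦cancel⟧ˢ : ∀ rs ss A → Σ⃗ rs ≡ Σ⃗ ss → ⟦ rs ∙ A ++ ss ∙ neg A ⟧ˢ ≡ 𝟘
  ⟦cancel⟧ˢ rs ss A Σrs≡Σss = begin
    ⟦ rs ∙ A ++ ss ∙ neg A ⟧ˢ             ≡⟨ ⟦∙++∙⟧ˢ rs A ss (neg A) ⟩
    Σ⃗ rs · ⟦ A ⟧ + Σ⃗ ss · ⟦ neg A ⟧      ≡⟨ cong₂ (λ s a → s · ⟦ A ⟧ + Σ⃗ ss · a) Σrs≡Σss (⟦neg⟧ A) ⟩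
    Σ⃗ ss · ⟦ A ⟧ + Σ⃗ ss · (- ⟦ A ⟧)     ≡⟨ cong (Σ⃗ ss · ⟦ A ⟧ +_) (·-negʳ (Σ⃗ ss) ⟦ A ⟧) ⟩
    Σ⃗ ss · ⟦ A ⟧ + - (Σ⃗ ss · ⟦ A ⟧)     ≡⟨ inverseʳ _ ⟩
    𝟘                                     ∎
    where open ≡-Reasoning

  ⟦zero⟧ˢ : ∀ rs → ⟦ rs ∙ zero ⟧ˢ ≡ 𝟘
  ⟦zero⟧ˢ rs = trans (⟦∙⟧ˢ rs zero) (·-zeroʳ (Σ⃗ rs))

  ⟦plus⟧ˢ : ∀ rs A B → ⟦ rs ∙ A ++ rs ∙ B ⟧ˢ ≡ ⟦ rs ∙ (A ⊕ B) ⟧ˢ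
  ⟦plus⟧ˢ rs A B = trans (⟦∙++∙⟧ˢ rs A rs B) (trans (sym (·-distrib-+ᵥ _ _ _)) (sym (⟦∙⟧ˢ rs (A ⊕ B))))

  ⟦one⟧ˢ : ∀ rs ss → ⟦ rs ∙ one ++ ss ∙ coone ⟧ˢ ≡ (Σ⃗ rs +ᵣ -ᵣ Σ⃗ ss) · 𝟙
  ⟦one⟧ˢ rs ss = trans (⟦∙++∙⟧ˢ rs one ss coone)
    (trans (cong (Σ⃗ rs · 𝟙 +_) (trans (·-negʳ (Σ⃗ ss) 𝟙) (sym (·-negˡ (Σ⃗ ss) 𝟙))))
           (sym (·-distrib-+ᵣ _ _ 𝟙)))

  Σ⃗-·-⊓ : ∀ rs a b → (Σ⃗ rs · a) ⊓ (Σ⃗ rs · b) ⊑ Σ⃗ rs · (a ⊓ b)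
  Σ⃗-·-⊓ [] a b = subst₂ _⊑_ refl (trans (·-zeroˡ a) (sym (·-zeroˡ (a ⊓ b)))) (⊓-lowerˡ _ _)
  Σ⃗-·-⊓ (r ∷ rs) a b = ≡⇒⊑ (sym (·-distribˡ-⊓ (Σ⃗⁺ r rs) a b))

  ⟦meet⟧ˢ : ∀ Γ rs A B → ⟦ Γ ++ rs ∙ A ⟧ˢ ⊓ ⟦ Γ ++ rs ∙ B ⟧ˢ ⊑ ⟦ Γ ++ rs ∙ (A ⊓ₜ B) ⟧ˢ
  ⟦meet⟧ˢ Γ rs A B = begin
    ⟦ Γ ++ rs ∙ A ⟧ˢ ⊓ ⟦ Γ ++ rs ∙ B ⟧ˢ               ≡⟨ cong₂ _⊓_ (⟦++⟧ˢ Γ _) (⟦++⟧ˢ Γ _) ⟩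
    (⟦ Γ ⟧ˢ + ⟦ rs ∙ A ⟧ˢ) ⊓ (⟦ Γ ⟧ˢ + ⟦ rs ∙ B ⟧ˢ)   ≡⟨ +-distribˡ-⊓ ⟦ Γ ⟧ˢ _ _ ⟨
    ⟦ Γ ⟧ˢ + (⟦ rs ∙ A ⟧ˢ ⊓ ⟦ rs ∙ B ⟧ˢ)               ≡⟨ cong (⟦ Γ ⟧ˢ +_) (cong₂ _⊓_ (⟦∙⟧ˢ rs A) (⟦∙⟧ˢ rs B)) ⟩
    ⟦ Γ ⟧ˢ + ((Σ⃗ rs · ⟦ A ⟧) ⊓ (Σ⃗ rs · ⟦ B ⟧))       ≤⟨ +-monoʳ-⊑ ⟦ Γ ⟧ˢ (Σ⃗-·-⊓ rs ⟦ A ⟧ ⟦ B ⟧) ⟩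
    ⟦ Γ ⟧ˢ + Σ⃗ rs · (⟦ A ⟧ ⊓ ⟦ B ⟧)                   ≡⟨ sym (trans (⟦++⟧ˢ Γ _) (cong (⟦ Γ ⟧ˢ +_) (⟦∙⟧ˢ rs (A ⊓ₜ B)))) ⟩
    ⟦ Γ ++ rs ∙ (A ⊓ₜ B) ⟧ˢ                           ∎
    where open ⊑-Reasoning

  ⟦dia⟧ˢ : ∀ Γ rs ss → Σ⃗ ss ≤ᵣ Σ⃗ rs → 𝟘 ⊑ ⟦ Γ ++ rs ∙ one ++ ss ∙ coone ⟧ˢ →
           𝟘 ⊑ ⟦ ◇Seq Γ ++ rs ∙ one ++ ss ∙ coone ⟧ˢ
  ⟦dia⟧ˢ Γ rs ss Σss≤Σrs 𝟘⊑ =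
    subst (𝟘 ⊑_) (sym ◇Γ≡) (𝟘⊑a+d𝟙⇒𝟘⊑◇a+d𝟙 (x≤y⇒0≤y-x Σss≤Σrs) (subst (𝟘 ⊑_) Γ≡ 𝟘⊑))
    where
    Γ≡ : ⟦ Γ ++ rs ∙ one ++ ss ∙ coone ⟧ˢ ≡ ⟦ Γ ⟧ˢ + (Σ⃗ rs +ᵣ -ᵣ Σ⃗ ss) · 𝟙
    Γ≡ = trans (⟦++⟧ˢ Γ _) (cong (⟦ Γ ⟧ˢ +_) (⟦one⟧ˢ rs ss))
    ◇Γ≡ : ⟦ ◇Seq Γ ++ rs ∙ one ++ ss ∙ coone ⟧ˢ ≡ ◇ ⟦ Γ ⟧ˢ + (Σ⃗ rs +ᵣ -ᵣ Σ⃗ ss) · 𝟙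
    ◇Γ≡ = trans (⟦++⟧ˢ (◇Seq Γ) _) (cong₂ _+_ (⟦◇Seq⟧ˢ Γ) (⟦one⟧ˢ rs ss))

  ⟦_⟧ᴴ : List Seq → List V
  ⟦ G ⟧ᴴ = map ⟦_⟧ˢ G

  Valid : Hyp → Set
  Valid H = NonnegJoin ⟦ toList H ⟧ᴴ

  ⟦∣⟧ᴴ : ∀ G Γ → ⟦ toList (G ∣ Γ) ⟧ᴴ ≡ ⟦ G ⟧ᴴ ∷ʳ ⟦ Γ ⟧ˢ
  ⟦∣⟧ᴴ [] Γ = refl
  ⟦∣⟧ᴴ (Δ ∷ G) Γ = cong (⟦ Δ ⟧ˢ ∷_) (map-++ ⟦_⟧ˢ G (Γ ∷ []))

  Valid-∣⁻ : ∀ G Γ → Valid (G ∣ Γ) → NonnegJoin (⟦ G ⟧ᴴ ∷ʳ ⟦ Γ ⟧ˢ)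
  Valid-∣⁻ G Γ = subst NonnegJoin (⟦∣⟧ᴴ G Γ)

  Valid-∣⁺ : ∀ G Γ → NonnegJoin (⟦ G ⟧ᴴ ∷ʳ ⟦ Γ ⟧ˢ) → Valid (G ∣ Γ)
  Valid-∣⁺ G Γ = subst NonnegJoin (sym (⟦∣⟧ᴴ G Γ))

  Valid-∣∣⁻ : ∀ G Γ Δ → Valid (toList (G ∣ Γ) ∣ Δ) → NonnegJoin (⟦ G ⟧ᴴ ∷ʳ ⟦ Γ ⟧ˢ ∷ʳ ⟦ Δ ⟧ˢ)
  Valid-∣∣⁻ G Γ Δ v = subst (λ us → NonnegJoin (us ∷ʳ ⟦ Δ ⟧ˢ)) (⟦∣⟧ᴴ G Γ) (Valid-∣⁻ (toList (G ∣ Γ)) Δ v)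

  Valid-∣∣⁺ : ∀ G Γ Δ → NonnegJoin (⟦ G ⟧ᴴ ∷ʳ ⟦ Γ ⟧ˢ ∷ʳ ⟦ Δ ⟧ˢ) → Valid (toList (G ∣ Γ) ∣ Δ)
  Valid-∣∣⁺ G Γ Δ h = Valid-∣⁺ (toList (G ∣ Γ)) Δ (subst (λ us → NonnegJoin (us ∷ʳ ⟦ Δ ⟧ˢ)) (sym (⟦∣⟧ᴴ G Γ)) h)

  Valid-monoʳ : ∀ G {Γ Δ} → ⟦ Γ ⟧ˢ ⊑ ⟦ Δ ⟧ˢ → Valid (G ∣ Γ) → Valid (G ∣ Δ)
  Valid-monoʳ G Γ⊑Δ v = Valid-∣⁺ G _ (NonnegJoin-monoʳ Γ⊑Δ (Valid-∣⁻ G _ v))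

  Valid-resp-≈H : ∀ {G G′} → G ≈H G′ → Valid G → Valid G′
  Valid-resp-≈H (H , G≋H , H↭G′) v = NonnegJoin-resp-↭ (↭ₚ.map⁺ ⟦_⟧ˢ H↭G′)
    (subst NonnegJoin (Pointwise-≡⇒≡ (Pointwise.map⁺ ⟦_⟧ˢ ⟦_⟧ˢ (Pointwise.map ⟦⟧ˢ-resp-↭ G≋H))) v)

  sound : ∀ {H} → Der H → Valid H
  sound INIT = NonnegJoin-[ ⊑-refl 𝟘 ]
  sound (EXCH G≈G′ d) = Valid-resp-≈H G≈G′ (sound d)
  sound (W {G} {Γ} d) = Valid-∣⁺ (toList G) Γ (NonnegJoin-weaken (sound d))
  sound (C {G} {Γ} d) = Valid-∣⁺ G Γ (NonnegJoin-contract (⊑-refl _) (⊑-refl _) (Valid-∣∣⁻ G Γ Γ (sound d)))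
  sound (S {G} {Γ₁} {Γ₂} d) =
    Valid-∣∣⁺ G Γ₁ Γ₂ (NonnegJoin-split (≡⇒⊑ (⟦++⟧ˢ Γ₁ Γ₂)) (Valid-∣⁻ G _ (sound d)))
  sound (M {G} {Γ₁} {Γ₂} d₁ d₂) = Valid-∣⁺ G _
    (NonnegJoin-+ (≡⇒⊑ (sym (⟦++⟧ˢ Γ₁ Γ₂))) (Valid-∣⁻ G _ (sound d₁)) (Valid-∣⁻ G _ (sound d₂)))
  sound (T {G} {Γ} {Δ} r Δ≡rΓ d) =
    Valid-∣⁺ G Γ (NonnegJoin-unscale r (≡⇒⊑ (⟦Scaled⟧ˢ r Δ≡rΓ)) (Valid-∣⁻ G Δ (sound d)))
  sound (ID {G} {Γ} rs ss x Σrs≡Σss d) =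
    Valid-monoʳ G (≡⇒⊑ (sym (⟦++⟧ˢ-identityʳ Γ (⟦cancel⟧ˢ rs ss (var x) Σrs≡Σss)))) (sound d)
  sound (ZERO {G} {Γ} rs d) = Valid-monoʳ G (≡⇒⊑ (sym (⟦++⟧ˢ-identityʳ Γ (⟦zero⟧ˢ rs)))) (sound d)
  sound (PLUS {G} {Γ} rs A B d) = Valid-monoʳ G (⟦++⟧ˢ-monoʳ Γ (≡⇒⊑ (⟦plus⟧ˢ rs A B))) (sound d)
  sound (TIMES {G} {Γ} rs ts s A ts≡srs d) =
    Valid-monoʳ G (⟦++⟧ˢ-monoʳ Γ (≡⇒⊑ (⟦ScaledW⟧ˢ A ts≡srs))) (sound d)
  sound (JOIN {G} {Γ} rs A B d) = Valid-∣⁺ G _ (NonnegJoin-contract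
    (⟦++⟧ˢ-monoʳ Γ (⟦∙⟧ˢ-mono rs (⊔-upperˡ ⟦ A ⟧ ⟦ B ⟧)))
    (⟦++⟧ˢ-monoʳ Γ (⟦∙⟧ˢ-mono rs (⊔-upperʳ ⟦ A ⟧ ⟦ B ⟧)))
    (Valid-∣∣⁻ G _ _ (sound d)))
  sound (MEET {G} {Γ} rs A B d₁ d₂) = Valid-∣⁺ G _
    (NonnegJoin-⊓ (⟦meet⟧ˢ Γ rs A B) (Valid-∣⁻ G _ (sound d₁)) (Valid-∣⁻ G _ (sound d₂)))
  sound (CAN {G} {Γ} rs ss A Σrs≡Σss d) =
    Valid-monoʳ G (≡⇒⊑ (⟦++⟧ˢ-identityʳ Γ (⟦cancel⟧ˢ ss rs A (sym Σrs≡Σss)))) (sound d)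
  sound (ONE {G} {Γ} rs ss Σss≤Σrs d) =
    Valid-monoʳ G (⟦⟧ˢ⊑⟦++⟧ˢ Γ (subst (𝟘 ⊑_) (sym (⟦one⟧ˢ rs ss)) (·-nonneg (x≤y⇒0≤y-x Σss≤Σrs) 𝟘⊑𝟙))) (sound d)
  sound (DIA {Γ} rs ss Σss≤Σrs d) = NonnegJoin-[ ⟦dia⟧ˢ Γ rs ss Σss≤Σrs (NonnegJoin⇒𝟘⊑⋁ _ (sound d)) ]

theorem4p5 : (F : RealField) → let open HMR F in
    (G : Hyp) → Der G →
    (M : ModalRiesz F) (σ : ℕ → ModalRiesz.V M) →
    ModalRiesz._⊑_ M (ModalRiesz.𝟘 M) (Sem.⟦_⟧ʰ M σ G)
theorem4p5 F G d M σ = NonnegJoin⇒𝟘⊑⋁ (List⁺.map ⟦_⟧ˢ G) (sound d)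
  where
  open Soundness M σ
  open ModalRieszSpaceProperties M using (NonnegJoin⇒𝟘⊑⋁)
  open HMR.Sem F M σ using (⟦_⟧ˢ)
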